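{- Let $\mathit{cs}_0$ be a finite constant specification and $A$ a justification formula with $\mathsf{J}^+_{\mathit{cs}_0}\vdash A$. Then there exist a finite constant specification $\mathit{cs}_1\supseteq\mathit{cs}_0$ and a ground second-sort justification term $s$ such that $\mathsf{J}^+_{\mathit{cs}_1}\vdash[s]_{\mathsf{tc}}A$. Moreover, if $\mathit{cs}_0$ is injective, then $\mathit{cs}_1$ can be chosen injective.
   Context: Justification terms of two sorts are built simultaneously from first-sort variables $x_0,x_1,\dots$, second-sort variables $y_0,y_1,\dots$ and second-sort constants $c_0,c_1,\dots$: first-sort $w::=x_i\mid(w\cdot w)\mid\mathsf{head}(s)\mid\mathsf{tail}(s)\mid(w+w)$; second-sort $s::=y_i\mid c_i\mid(s\cdot s)\mid\mathsf{ind}(w,s)\mid(s+s)$. A term is ground if it contains no variables. Formulas: $A::=p_i\mid\bot\mid(A\to A)\mid[w]A\mid[s]_{\mathsf{tc}}A$; $\neg A:=A\to\bot$, $A\wedge B:=\neg(A\to\neg B)$, $A\vee B:=\neg A\to B$. $\mathsf{J}^+_0$ has the rule modus ponens and axioms (for all formulas $A,B,C$, first-sort $h,w$, second-sort $t,s$): (i) $A\to(B\to A)$; (ii) $(A\to(B\to C))\to((A\to B)\to(A\to C))$; (iii) $\neg\neg A\to A$; (iv) $[h](A\to B)\to([w]A\to[h\cdot w]B)$; (v) $[h]A\vee[w]A\to[h+w]A$; (vi) $[t]_{\mathsf{tc}}(A\to B)\to([s]_{\mathsf{tc}}A\to[t\cdot s]_{\mathsf{tc}}B)$; (vii) $[s]_{\mathsf{tc}}A\to[\mathsf{head}(s)]A$;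 (viii) $[s]_{\mathsf{tc}}A\to[\mathsf{tail}(s)][s]_{\mathsf{tc}}A$; (ix) $[w]A\wedge[s]_{\mathsf{tc}}(A\to[w]A)\to[\mathsf{ind}(w,s)]_{\mathsf{tc}}A$; (x) $[t]_{\mathsf{tc}}A\vee[s]_{\mathsf{tc}}A\to[t+s]_{\mathsf{tc}}A$. A constant specification is a set of formulas $[c]_{\mathsf{tc}}A$ with $c$ a constant and $A$ an axiom of $\mathsf{J}^+_0$; $\mathsf{J}^+_{\mathit{cs}}$ is $\mathsf{J}^+_0$ with the members of $\mathit{cs}$ added as axioms. $\mathit{cs}$ is injective if $[c]_{\mathsf{tc}}A,[c]_{\mathsf{tc}}B\in\mathit{cs}$ implies $A=B$. -}

module Defs where

open import Data.Nat using (ℕ)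
open import Data.List using (List)
open import Data.List.Membership.Propositional using (_∈_)
open import Data.List.Relation.Unary.All using (All)
open import Data.Product using (_×_; _,_)
open import Relation.Binary.PropositionalEquality using (_≡_)

mutual
  data Tm₁ : Set where
    x     : ℕ → Tm₁
    _·₁_  : Tm₁ → Tm₁ → Tm₁
    head  : Tm₂ → Tm₁
    tail  : Tm₂ → Tm₁
    _+₁_  : Tm₁ → Tm₁ → Tm₁

  data Tm₂ : Set where
    y     : ℕ → Tm₂
    c     : ℕ → Tm₂
    _·₂_  : Tm₂ → Tm₂ → Tm₂
    ind   : Tm₁ → Tm₂ → Tm₂
    _+₂_  : Tm₂ → Tm₂ → Tm₂

mutual
  data Ground₁ : Tm₁ → Set where
    g·₁   : ∀ {h w} → Ground₁ h → Ground₁ w → Ground₁ (h ·₁ w)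
    ghead : ∀ {s} → Ground₂ s → Ground₁ (head s)
    gtail : ∀ {s} → Ground₂ s → Ground₁ (tail s)
    g+₁   : ∀ {h w} → Ground₁ h → Ground₁ w → Ground₁ (h +₁ w)

  data Ground₂ : Tm₂ → Set where
    gc    : ∀ i → Ground₂ (c i)
    g·₂   : ∀ {t s} → Ground₂ t → Ground₂ s → Ground₂ (t ·₂ s)
    gind  : ∀ {w s} → Ground₁ w → Ground₂ s → Ground₂ (ind w s)
    g+₂   : ∀ {t s} → Ground₂ t → Ground₂ s → Ground₂ (t +₂ s)

infixr 5 _⇒_
data Fm : Set where
  p      : ℕ → Fm
  ⊥'     : Fm
  _⇒_    : Fm → Fm → Fm
  [_]_   : Tm₁ → Fm → Fm
  [_]tc_ : Tm₂ → Fm → Fm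

¬' : Fm → Fm
¬' A = A ⇒ ⊥'

_∧'_ : Fm → Fm → Fm
A ∧' B = ¬' (A ⇒ ¬' B)

_∨'_ : Fm → Fm → Fm
A ∨' B = ¬' A ⇒ B

data Axiom : Fm → Set where
  ax1  : ∀ A B → Axiom (A ⇒ (B ⇒ A))
  ax2  : ∀ A B C → Axiom ((A ⇒ (B ⇒ C)) ⇒ ((A ⇒ B) ⇒ (A ⇒ C)))
  ax3  : ∀ A → Axiom (¬' (¬' A) ⇒ A)
  ax4  : ∀ h w A B → Axiom (([ h ] (A ⇒ B)) ⇒ (([ w ] A) ⇒ ([ h ·₁ w ] B)))
  ax5  : ∀ h w A → Axiom ((([ h ] A) ∨' ([ w ] A)) ⇒ ([ h +₁ w ] A))
  ax6  : ∀ t s A B → Axiom (([ t ]tc (A ⇒ B)) ⇒ (([ s ]tc A) ⇒ ([ t ·₂ s ]tc B)))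
  ax7  : ∀ s A → Axiom (([ s ]tc A) ⇒ ([ head s ] A))
  ax8  : ∀ s A → Axiom (([ s ]tc A) ⇒ ([ tail s ] ([ s ]tc A)))
  ax9  : ∀ w s A → Axiom ((([ w ] A) ∧' ([ s ]tc (A ⇒ [ w ] A))) ⇒ ([ ind w s ]tc A))
  ax10 : ∀ t s A → Axiom ((([ t ]tc A) ∨' ([ s ]tc A)) ⇒ ([ t +₂ s ]tc A))

-- A finite constant specification: a finite list of pairs (i , A), standing for
-- the formula [c_i]_tc A, where each A is an axiom of J⁺₀.
CSEntry : Set
CSEntry = ℕ × Fm

record FinCS : Set where
  constructor mkCS
  field
    entries : List CSEntry
    axioms  : All (λ e → Axiom (Data.Product.proj₂ e)) entries
open FinCS public

_⊆cs_ : FinCS → FinCS → Set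
cs₀ ⊆cs cs₁ = ∀ {e} → e ∈ entries cs₀ → e ∈ entries cs₁

Injective : FinCS → Set
Injective cs = ∀ {i A B} → (i , A) ∈ entries cs → (i , B) ∈ entries cs → A ≡ B

data _⊢_ (cs : FinCS) : Fm → Set where
  axiom : ∀ {A} → Axiom A → cs ⊢ A
  csax  : ∀ {i A} → (i , A) ∈ entries cs → cs ⊢ ([ c i ]tc A)
  mp    : ∀ {A B} → cs ⊢ (A ⇒ B) → cs ⊢ A → cs ⊢ B

{-# OPTIONS --safe #-}
-- Induction on the derivation, enlarging the constant specification along the way.
-- An axiom A is justified by a fresh constant c with [c]_tc A. A member [c_i]_tc B of cs is
-- justified by ind(tail c_i, c), where the fresh c justifies the instance
-- [c_i]_tc B → [tail c_i][c_i]_tc B of axiom (viii), via axiom (ix). Modus ponens is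
-- internalized by axiom (vi). New constants are always fresh, so injectivity is preserved.
module Submission where

open import Defs
open import Data.Product using (Σ; _×_; _,_)
open import Data.Nat using (ℕ; suc; _<_; _⊔_)
open import Data.Nat.Properties using (m≤m⊔n; m<n⇒m<o⊔n; n≮n)
open import Data.List using (List; []; _∷_)
open import Data.List.Relation.Unary.All using (_∷_)
open import Data.List.Relation.Unary.Any using (here; there)
open import Data.List.Membership.Propositional using (_∈_)
open import Data.Empty using (⊥-elim)
open import Relation.Binary.PropositionalEquality using (refl)

module _ {cs : FinCS} where

  ⊢-id : ∀ {A} → cs ⊢ (A ⇒ A)
  ⊢-id {A} = mp (mp (axiom (ax2 A (A ⇒ A) A)) (axiom (ax1 A (A ⇒ A)))) (axiom (ax1 A A))

  ⊢-const : ∀ {A B} → cs ⊢ B → cs ⊢ (A ⇒ B)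
  ⊢-const {A} {B} ⊢B = mp (axiom (ax1 B A)) ⊢B

  ⊢-S : ∀ {A B C} → cs ⊢ (A ⇒ (B ⇒ C)) → cs ⊢ (A ⇒ B) → cs ⊢ (A ⇒ C)
  ⊢-S {A} {B} {C} ⊢A⇒B⇒C ⊢A⇒B = mp (mp (axiom (ax2 A B C)) ⊢A⇒B⇒C) ⊢A⇒B

  ⊢-∧-intro : ∀ {A B} → cs ⊢ A → cs ⊢ B → cs ⊢ (A ∧' B)
  ⊢-∧-intro ⊢A ⊢B = ⊢-S (⊢-S ⊢-id (⊢-const ⊢A)) (⊢-const ⊢B)

  ⊢-tc-app : ∀ {t s A B} → cs ⊢ ([ t ]tc (A ⇒ B)) → cs ⊢ ([ s ]tc A) → cs ⊢ ([ t ·₂ s ]tc B)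
  ⊢-tc-app ⊢t ⊢s = mp (mp (axiom (ax6 _ _ _ _)) ⊢t) ⊢s

  ⊢-tc-introspect : ∀ {t s A} →
    cs ⊢ ([ t ]tc (([ s ]tc A) ⇒ ([ tail s ] ([ s ]tc A)))) →
    cs ⊢ ([ s ]tc A) → cs ⊢ ([ ind (tail s) t ]tc ([ s ]tc A))
  ⊢-tc-introspect ⊢t ⊢s =
    mp (axiom (ax9 _ _ _)) (⊢-∧-intro (mp (axiom (ax8 _ _)) ⊢s) ⊢t)

⊢-mono : ∀ {cs cs′ A} → cs ⊆cs cs′ → cs ⊢ A → cs′ ⊢ A
⊢-mono cs⊆cs′ (axiom a)     = axiom a
⊢-mono cs⊆cs′ (csax i,A∈cs) = csax (cs⊆cs′ i,A∈cs)
⊢-mono cs⊆cs′ (mp ⊢A⇒B ⊢A)  = mp (⊢-mono cs⊆cs′ ⊢A⇒B) (⊢-mono cs⊆cs′ ⊢A)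

fresh : List CSEntry → ℕ
fresh []             = 0
fresh ((i , _) ∷ es) = suc i ⊔ fresh es

index<fresh : ∀ {i A} es → (i , A) ∈ es → i < fresh es
index<fresh ((i , _) ∷ es) (here refl) = m≤m⊔n (suc i) (fresh es)
index<fresh ((j , _) ∷ es) (there i,A∈es) = m<n⇒m<o⊔n (suc j) (index<fresh es i,A∈es)

freshConstant : FinCS → Tm₂
freshConstant cs = c (fresh (entries cs))

declareFresh : (cs : FinCS) (A : Fm) → Axiom A → FinCS
declareFresh cs A a = mkCS ((fresh (entries cs) , A) ∷ entries cs) (a ∷ axioms cs)

module _ (cs : FinCS) {A : Fm} (a : Axiom A) where

  ⊆-declareFresh : cs ⊆cs declareFresh cs A a
  ⊆-declareFresh = there

  declareFresh-⊢ : declareFresh cs A a ⊢ ([ freshConstant cs ]tc A)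
  declareFresh-⊢ = csax (here refl)

  declareFresh-injective : Injective cs → Injective (declareFresh cs A a)
  declareFresh-injective _   (here refl)    (here refl)    = refl
  declareFresh-injective _   (here refl)    (there i,B∈cs) = ⊥-elim (n≮n _ (index<fresh (entries cs) i,B∈cs))
  declareFresh-injective _   (there i,A∈cs) (here refl)    = ⊥-elim (n≮n _ (index<fresh (entries cs) i,A∈cs))
  declareFresh-injective inj (there i,A∈cs) (there i,B∈cs) = inj i,A∈cs i,B∈cs

record Internalization (cs : FinCS) (A : Fm) : Set where
  constructor internalization
  field
    extension           : FinCS
    ⊆-extension         : cs ⊆cs extension
    extension-injective : Injective cs → Injective extension
    witness             : Tm₂
    witness-ground      : Ground₂ witness
    extension-⊢-witness : extension ⊢ ([ witness ]tc A)

internalizationByFreshAxiom : ∀ (cs : FinCS) {X A} (a : Axiom X) (s : Tm₂) → Ground₂ s →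
  declareFresh cs X a ⊢ ([ s ]tc A) → Internalization cs A
internalizationByFreshAxiom cs a =
  internalization (declareFresh cs _ a) (⊆-declareFresh cs a) (declareFresh-injective cs a)

-- Internalizing over an arbitrary cs′ ⊇ cs keeps the recursion structural: the minor
-- premise of modus ponens is internalized over the extension built for the major one.
internalize : ∀ {cs A} → cs ⊢ A → (cs′ : FinCS) → cs ⊆cs cs′ → Internalization cs′ A
internalize (axiom a) cs′ _ =
  internalizationByFreshAxiom cs′ a (freshConstant cs′) (gc _) (declareFresh-⊢ cs′ a)
internalize (csax {i} {B} i,B∈cs) cs′ cs⊆cs′ =
  internalizationByFreshAxiom cs′ a (ind (tail (c i)) (freshConstant cs′)) (gind (gtail (gc i)) (gc _))
    (⊢-tc-introspect (declareFresh-⊢ cs′ a) (csax (there (cs⊆cs′ i,B∈cs))))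
  where a = ax8 (c i) B
internalize (mp ⊢A⇒B ⊢A) cs′ cs⊆cs′ = record
  { extension           = I₂.extension
  ; ⊆-extension         = λ e∈cs′ → I₂.⊆-extension (I₁.⊆-extension e∈cs′)
  ; extension-injective = λ inj → I₂.extension-injective (I₁.extension-injective inj)
  ; witness             = I₁.witness ·₂ I₂.witness
  ; witness-ground      = g·₂ I₁.witness-ground I₂.witness-ground
  ; extension-⊢-witness = ⊢-tc-app (⊢-mono I₂.⊆-extension I₁.extension-⊢-witness) I₂.extension-⊢-witness
  }
  where
  module I₁ = Internalization (internalize ⊢A⇒B cs′ cs⊆cs′)
  module I₂ = Internalization (internalize ⊢A I₁.extension (λ e∈cs → I₁.⊆-extension (cs⊆cs′ e∈cs)))

mainTheorem6 : (cs₀ : FinCS) (A : Fm) → cs₀ ⊢ A →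
    Σ FinCS (λ cs₁ → Σ Tm₂ (λ s →
      (cs₀ ⊆cs cs₁) × Ground₂ s × (cs₁ ⊢ ([ s ]tc A))))
    × (Injective cs₀ → Σ FinCS (λ cs₁ → Σ Tm₂ (λ s →
      (cs₀ ⊆cs cs₁) × Ground₂ s × (cs₁ ⊢ ([ s ]tc A)) × Injective cs₁)))
mainTheorem6 cs₀ A ⊢A =
  (extension , witness , ⊆-extension , witness-ground , extension-⊢-witness) ,
  λ inj → extension , witness , ⊆-extension , witness-ground , extension-⊢-witness , extension-injective inj
  where open Internalization (internalize ⊢A cs₀ (λ e∈cs₀ → e∈cs₀))
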